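{- Let $n\geqslant 14$ be even and let $\lambda$ be an integer with $1\leqslant\lambda\leqslant\frac{n-4}{10}$. Then $\left(\frac{n-6\lambda}{2},\ 2\lambda+2,\ \lambda+3,\ 3\times(\lambda-1),\ 2\times\lambda,\ 1\times\frac{n-10\lambda-4}{2}\right)$ is a partition of $n$ and it corresponds to the eigenvalue $\lambda$ of the Transposition graph $T_n$; in particular $\lambda$ is an eigenvalue of $T_n$.
   Context: The Transposition graph $T_n$ is the Cayley graph on the symmetric group $\mathrm{Sym}_n$ generated by the set of all transpositions. Its eigenvalues (of the adjacency matrix) are indexed by partitions of $n$: to a partition $\mathbf{i}=(n_1,\dots,n_k)\vdash n$ with $n_1\geqslant\dots\geqslant n_k\geqslant 1$ corresponds the eigenvalue $\lambda_{\mathbf i}=\sum_{j=1}^k \frac{n_j(n_j-2j+1)}{2}$ of $T_n$, and every eigenvalue arises this way. "The partition $\mathbf i$ corresponds to the eigenvalue $\lambda$" means $\lambda_{\mathbf i}=\lambda$. The notation $a\times t$ inside a partition means the part $a$ repeated $t$ times ($t\geqslant 0$, so $t=0$ means the part is absent). -}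

module Defs where

open import Data.Nat using (ℕ; zero; suc; _+_; _*_; _≥_; _/_)
open import Data.Integer as ℤ using (ℤ; +_)
open import Data.List using (List; []; _∷_)
open import Data.Nat.ListAction using (sum)
open import Data.List.Relation.Unary.All using (All)
open import Data.List.Relation.Unary.Linked using (Linked)
open import Data.Product using (Σ; _×_)
open import Relation.Binary.PropositionalEquality using (_≡_)

IsPartition : ℕ → List ℕ → Set
IsPartition n ps = All (λ a → a ≥ 1) ps × Linked _≥_ ps × sum ps ≡ n

-- n_j (n_j - 2j + 1) / 2  =  n_j (n_j + 1) / 2 - j n_j   (exact, computed in ℤ)
term : ℕ → ℕ → ℤ
term j a = + ((a * (a + 1)) / 2) ℤ.- + (j * a)

eigFrom : ℕ → List ℕ → ℤ
eigFrom j [] = + 0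
eigFrom j (a ∷ as) = term j a ℤ.+ eigFrom (suc j) as

eigenvalueOf : List ℕ → ℤ
eigenvalueOf = eigFrom 1

-- λ is an eigenvalue of T_n iff λ = λ_i for some partition i ⊢ n
IsEigenvalueT : ℕ → ℤ → Set
IsEigenvalueT n μ = Σ (List ℕ) λ ps → IsPartition n ps × eigenvalueOf ps ≡ μ

-- Since n(n+1) is even, doubling clears the halving: 2λᵢ = Σⱼ (nⱼ(nⱼ+1) − 2j nⱼ).  A run of t
-- parts equal to a occupying rows j, …, j+t−1 then contributes a closed polynomial in j, t, a.
-- Writing λ = k + 1 and n = 10λ + 4 + 2r (possible because n is even), the given partition
-- consists of six such runs, and its doubled eigenvalue is a polynomial identity in k and r
-- that evaluates to 2λ.
module Submission where

open import Defs
open import Data.Nat using (ℕ; zero; suc; _+_; _*_; _∸_; _/_; _≤_; _≥_; s≤s; z≤n)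
open import Data.Nat.Divisibility using (_∣_; divides; _∣0; m∣m*n; ∣m∣n⇒∣m+n; ∣m+n∣m⇒∣n)
open import Data.Nat.DivMod using (m*n/n≡m; m/n*n≡m)
import Data.Nat.Properties as ℕ
open import Data.Nat.ListAction using (sum)
open import Data.Nat.ListAction.Properties using (sum-++)
open import Data.Nat.Tactic.RingSolver using (solve-∀)
open import Data.Integer as ℤ using (ℤ; +_)
import Data.Integer.Properties as ℤ
import Data.Integer.Tactic.RingSolver as ℤ-Solver
open import Data.List using (List; []; _∷_; _++_; replicate; length; map)
open import Data.List.Properties using (length-replicate; ++-identityʳ)
open import Data.List.Relation.Unary.All using (All; []; _∷_)
open import Data.List.Relation.Unary.All.Properties using (++⁺; replicate⁺)
open import Data.List.Relation.Unary.Linked as Linked using (Linked; []; [-]; _∷_)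
open import Data.Product using (Σ; _×_; _,_; proj₁; proj₂; uncurry)
open import Relation.Binary.PropositionalEquality
  using (_≡_; refl; sym; trans; cong; cong₂; subst; module ≡-Reasoning)

2∣n*[n+1] : ∀ n → 2 ∣ n * (n + 1)
2∣n*[n+1] zero    = 2 ∣0
2∣n*[n+1] (suc n) = subst (2 ∣_) (step n) (∣m∣n⇒∣m+n (2∣n*[n+1] n) (m∣m*n (n + 1)))
  where
  step : ∀ n → n * (n + 1) + 2 * (n + 1) ≡ suc n * (suc n + 1)
  step = solve-∀

term-doubled : ∀ j a → + 2 ℤ.* term j a ≡ + a ℤ.* (+ a ℤ.+ + 1) ℤ.- + 2 ℤ.* + j ℤ.* + a
term-doubled j a = begin
  + 2 ℤ.* (+ (a * (a + 1) / 2) ℤ.- + (j * a))           ≡⟨ distrib (+ (a * (a + 1) / 2)) (+ (j * a)) ⟩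
  + 2 ℤ.* + (a * (a + 1) / 2) ℤ.- + 2 ℤ.* + (j * a)     ≡⟨ cong₂ ℤ._-_ (sym (ℤ.pos-* 2 (a * (a + 1) / 2))) (cong (+ 2 ℤ.*_) (ℤ.pos-* j a)) ⟩
  + (2 * (a * (a + 1) / 2)) ℤ.- + 2 ℤ.* (+ j ℤ.* + a)   ≡⟨ cong₂ ℤ._-_ (cong +_ halve) (sym (ℤ.*-assoc (+ 2) (+ j) (+ a))) ⟩
  + (a * (a + 1)) ℤ.- + 2 ℤ.* + j ℤ.* + a               ≡⟨ cong (ℤ._- (+ 2 ℤ.* + j ℤ.* + a)) (ℤ.pos-* a (a + 1)) ⟩
  + a ℤ.* (+ a ℤ.+ + 1) ℤ.- + 2 ℤ.* + j ℤ.* + a         ∎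
  where
  open ≡-Reasoning
  distrib : ∀ x y → + 2 ℤ.* (x ℤ.- y) ≡ + 2 ℤ.* x ℤ.- + 2 ℤ.* y
  distrib = ℤ-Solver.solve-∀
  halve : 2 * (a * (a + 1) / 2) ≡ a * (a + 1)
  halve = trans (ℕ.*-comm 2 (a * (a + 1) / 2)) (m/n*n≡m (2∣n*[n+1] a))

eigFrom-++ : ∀ j xs ys → eigFrom j (xs ++ ys) ≡ eigFrom j xs ℤ.+ eigFrom (length xs + j) ys
eigFrom-++ j []       ys = sym (ℤ.+-identityˡ _)
eigFrom-++ j (x ∷ xs) ys = begin
  term j x ℤ.+ eigFrom (suc j) (xs ++ ys)
    ≡⟨ cong (λ e → term j x ℤ.+ e) (eigFrom-++ (suc j) xs ys) ⟩
  term j x ℤ.+ (eigFrom (suc j) xs ℤ.+ eigFrom (length xs + suc j) ys)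
    ≡⟨ cong (λ i → term j x ℤ.+ (eigFrom (suc j) xs ℤ.+ eigFrom i ys)) (ℕ.+-suc (length xs) j) ⟩
  term j x ℤ.+ (eigFrom (suc j) xs ℤ.+ eigFrom (suc (length xs + j)) ys)
    ≡⟨ ℤ.+-assoc (term j x) _ _ ⟨
  eigFrom j (x ∷ xs) ℤ.+ eigFrom (length (x ∷ xs) + j) ys ∎
  where open ≡-Reasoning

-- t parts equal to a in rows j, …, j + t − 1 contribute Σᵢ (a(a+1) − 2(j+i)a) = ta(a+2) − at(2j+t).
doubledBlock : ℕ → ℕ → ℕ → ℤ
doubledBlock j t a = + t ℤ.* + a ℤ.* (+ a ℤ.+ + 2) ℤ.- + a ℤ.* + t ℤ.* (+ 2 ℤ.* + j ℤ.+ + t)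

eigFrom-replicate-doubled : ∀ j t a → + 2 ℤ.* eigFrom j (replicate t a) ≡ doubledBlock j t a
eigFrom-replicate-doubled j zero    a = empty (+ a) (+ j)
  where
  empty : ∀ a j → + 0 ≡ + 0 ℤ.* a ℤ.* (a ℤ.+ + 2) ℤ.- a ℤ.* + 0 ℤ.* (+ 2 ℤ.* j ℤ.+ + 0)
  empty = ℤ-Solver.solve-∀
eigFrom-replicate-doubled j (suc t) a = begin
  + 2 ℤ.* (term j a ℤ.+ eigFrom (suc j) (replicate t a))
    ≡⟨ ℤ.*-distribˡ-+ (+ 2) (term j a) _ ⟩
  + 2 ℤ.* term j a ℤ.+ + 2 ℤ.* eigFrom (suc j) (replicate t a)
    ≡⟨ cong₂ ℤ._+_ (term-doubled j a) (eigFrom-replicate-doubled (suc j) t a) ⟩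
  _ ≡⟨ cons (+ j) (+ t) (+ a) ⟩
  doubledBlock j (suc t) a ∎
  where
  open ≡-Reasoning
  cons : ∀ j t a →
    (a ℤ.* (a ℤ.+ + 1) ℤ.- + 2 ℤ.* j ℤ.* a) ℤ.+ (t ℤ.* a ℤ.* (a ℤ.+ + 2) ℤ.- a ℤ.* t ℤ.* (+ 2 ℤ.* (+ 1 ℤ.+ j) ℤ.+ t))
      ≡ (+ 1 ℤ.+ t) ℤ.* a ℤ.* (a ℤ.+ + 2) ℤ.- a ℤ.* (+ 1 ℤ.+ t) ℤ.* (+ 2 ℤ.* j ℤ.+ (+ 1 ℤ.+ t))
  cons = ℤ-Solver.solve-∀

blocks : List (ℕ × ℕ) → List ℕ
blocks []             = []
blocks ((t , a) ∷ bs) = replicate t a ++ blocks bs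

doubledEigFrom : ℕ → List (ℕ × ℕ) → ℤ
doubledEigFrom j []             = + 0
doubledEigFrom j ((t , a) ∷ bs) =
  doubledBlock j t a ℤ.+ doubledEigFrom (t + j) bs

eigFrom-blocks : ∀ j bs → + 2 ℤ.* eigFrom j (blocks bs) ≡ doubledEigFrom j bs
eigFrom-blocks j []             = refl
eigFrom-blocks j ((t , a) ∷ bs) = begin
  + 2 ℤ.* eigFrom j (replicate t a ++ blocks bs)
    ≡⟨ cong (+ 2 ℤ.*_) (eigFrom-++ j (replicate t a) (blocks bs)) ⟩
  + 2 ℤ.* (eigFrom j (replicate t a) ℤ.+ eigFrom (length (replicate t a) + j) (blocks bs))
    ≡⟨ ℤ.*-distribˡ-+ (+ 2) (eigFrom j (replicate t a)) _ ⟩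
  + 2 ℤ.* eigFrom j (replicate t a) ℤ.+ + 2 ℤ.* eigFrom (length (replicate t a) + j) (blocks bs)
    ≡⟨ cong₂ ℤ._+_ (eigFrom-replicate-doubled j t a)
                   (cong (λ i → + 2 ℤ.* eigFrom (i + j) (blocks bs)) (length-replicate t)) ⟩
  doubledBlock j t a ℤ.+ + 2 ℤ.* eigFrom (t + j) (blocks bs)
    ≡⟨ cong (λ e → doubledBlock j t a ℤ.+ e) (eigFrom-blocks (t + j) bs) ⟩
  doubledEigFrom j ((t , a) ∷ bs) ∎
  where open ≡-Reasoning

sum-replicate : ∀ t a → sum (replicate t a) ≡ t * a
sum-replicate zero    a = refl
sum-replicate (suc t) a = cong (λ s → a + s) (sum-replicate t a)

sum-blocks : ∀ bs → sum (blocks bs) ≡ sum (map (uncurry _*_) bs)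
sum-blocks []             = refl
sum-blocks ((t , a) ∷ bs) =
  trans (sum-++ (replicate t a) (blocks bs)) (cong₂ _+_ (sum-replicate t a) (sum-blocks bs))

blocks⁺ : ∀ {P : ℕ → Set} bs → All P (map proj₂ bs) → All P (blocks bs)
blocks⁺ []             []         = []
blocks⁺ ((t , a) ∷ bs) (pa ∷ pbs) = ++⁺ (replicate⁺ t pa) (blocks⁺ bs pbs)

∷-replicate-++-linked : ∀ t {x a ys} → x ≥ a → Linked _≥_ (a ∷ ys) → Linked _≥_ (x ∷ replicate t a ++ ys)
∷-replicate-++-linked zero    x≥a [-]         = [-]
∷-replicate-++-linked zero    x≥a (a≥y ∷ ys↓) = ℕ.≤-trans a≥y x≥a ∷ ys↓
∷-replicate-++-linked (suc t) x≥a ys↓         = x≥a ∷ ∷-replicate-++-linked t ℕ.≤-refl ys↓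

∷-blocks-linked : ∀ {x} bs → Linked _≥_ (x ∷ map proj₂ bs) → Linked _≥_ (x ∷ blocks bs)
∷-blocks-linked []             [-]          = [-]
∷-blocks-linked ((t , a) ∷ bs) (x≥a ∷ as↓) = ∷-replicate-++-linked t x≥a (∷-blocks-linked bs as↓)

blocks-linked : ∀ bs → Linked _≥_ (map proj₂ bs) → Linked _≥_ (blocks bs)
blocks-linked []                 []  = []
blocks-linked ((zero  , a) ∷ bs) as↓ = blocks-linked bs (Linked.tail as↓)
blocks-linked ((suc t , a) ∷ bs) as↓ = ∷-replicate-++-linked t ℕ.≤-refl (∷-blocks-linked bs as↓)

blocks-isPartition : ∀ bs → All (_≥ 1) (map proj₂ bs) → Linked _≥_ (map proj₂ bs) →
                     IsPartition (sum (map (uncurry _*_) bs)) (blocks bs)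
blocks-isPartition bs pos as↓ = blocks⁺ bs pos , blocks-linked bs as↓ , sum-blocks bs

divisible-excess : ∀ {d m n} → d ∣ m → d ∣ n → m ≤ n → Σ ℕ λ q → n ≡ m + q * d
divisible-excess {d} {m} {n} d∣m d∣n m≤n
  with ∣m+n∣m⇒∣n (subst (d ∣_) (sym (ℕ.m+[n∸m]≡n m≤n)) d∣n) d∣m
... | divides q n∸m≡q*d = q , trans (sym (ℕ.m+[n∸m]≡n m≤n)) (cong (λ s → m + s) n∸m≡q*d)

m+n*2∸m/2≡n : ∀ m n → (m + n * 2 ∸ m) / 2 ≡ n
m+n*2∸m/2≡n m n = trans (cong (_/ 2) (ℕ.m+n∸m≡n m (n * 2))) (m*n/n≡m n 2)

largest-part : ∀ l r → (10 * l + 4 + r * 2 ∸ 6 * l) / 2 ≡ 2 * l + 2 + r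
largest-part l r = trans (cong (λ m → (m ∸ 6 * l) / 2) (regroup l r)) (m+n*2∸m/2≡n (6 * l) (2 * l + 2 + r))
  where
  regroup : ∀ l r → 10 * l + 4 + r * 2 ≡ 6 * l + (2 * l + 2 + r) * 2
  regroup = solve-∀

ones-count : ∀ l r → (10 * l + 4 + r * 2 ∸ 10 * l ∸ 4) / 2 ≡ r
ones-count l r = trans (cong (_/ 2) (ℕ.∸-+-assoc (10 * l + 4 + r * 2) (10 * l) 4)) (m+n*2∸m/2≡n (10 * l + 4) r)

witness : ℕ → ℕ → List (ℕ × ℕ)
witness k r =
  (1 , 2 * suc k + 2 + r) ∷ (1 , 2 * suc k + 2) ∷ (1 , suc k + 3) ∷ (k , 3) ∷ (suc k , 2) ∷ (r , 1) ∷ []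

witness-isPartition : ∀ k r → IsPartition (10 * suc k + 4 + r * 2) (blocks (witness k r))
witness-isPartition k r = subst (λ n → IsPartition n (blocks (witness k r))) (size k r)
  (blocks-isPartition (witness k r) positive decreasing)
  where
  size : ∀ k r →
    1 * (2 * suc k + 2 + r) + (1 * (2 * suc k + 2) + (1 * (suc k + 3) + (k * 3 + (suc k * 2 + (r * 1 + 0)))))
      ≡ 10 * suc k + 4 + r * 2
  size = solve-∀
  positive : All (_≥ 1) (map proj₂ (witness k r))
  positive = s≤s z≤n ∷ s≤s z≤n ∷ s≤s z≤n ∷ s≤s z≤n ∷ s≤s z≤n ∷ s≤s z≤n ∷ []
  2l+2≥l+3 : 2 * suc k + 2 ≥ suc k + 3
  2l+2≥l+3 = subst (_≥ suc k + 3) (regroup k) (ℕ.m≤m+n (suc k + 3) k)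
    where
    regroup : ∀ k → suc k + 3 + k ≡ 2 * suc k + 2
    regroup = solve-∀
  decreasing : Linked _≥_ (map proj₂ (witness k r))
  decreasing = ℕ.m≤m+n _ r ∷ 2l+2≥l+3 ∷ ℕ.m≤n+m 3 (suc k) ∷ s≤s (s≤s z≤n) ∷ s≤s z≤n ∷ [-]

witness-eigenvalue : ∀ k r → eigenvalueOf (blocks (witness k r)) ≡ + suc k
witness-eigenvalue k r = ℤ.*-cancelˡ-≡ (+ 2) (eigenvalueOf (blocks (witness k r))) (+ suc k) (begin
  + 2 ℤ.* eigFrom 1 (blocks (witness k r))   ≡⟨ eigFrom-blocks 1 (witness k r) ⟩
  doubledEigFrom 1 (witness k r)             ≡⟨ doubled (+ k) (+ r) ⟩
  + 2 ℤ.* + suc k                            ∎)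
  where
  open ≡-Reasoning
  -- The ring solver does not unfold doubledBlock, so the identity spells it out.
  doubled : ∀ k r →
    let block : ℤ → ℤ → ℤ → ℤ
        block j t a = t ℤ.* a ℤ.* (a ℤ.+ + 2) ℤ.- a ℤ.* t ℤ.* (+ 2 ℤ.* j ℤ.+ t)
        l = + 1 ℤ.+ k
    in block (+ 1) (+ 1) (+ 2 ℤ.* l ℤ.+ + 2 ℤ.+ r) ℤ.+ (block (+ 2) (+ 1) (+ 2 ℤ.* l ℤ.+ + 2) ℤ.+
       (block (+ 3) (+ 1) (l ℤ.+ + 3) ℤ.+ (block (+ 4) k (+ 3) ℤ.+ (block (k ℤ.+ + 4) l (+ 2) ℤ.+
       (block (l ℤ.+ (k ℤ.+ + 4)) r (+ 1) ℤ.+ + 0)))))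
       ≡ + 2 ℤ.* l
  doubled = ℤ-Solver.solve-∀

Eigenpartition : ℕ → ℕ → List ℕ → Set
Eigenpartition n l xs = IsPartition n xs × eigenvalueOf xs ≡ + l

partition : ℕ → ℕ → List ℕ
partition n l = (n ∸ 6 * l) / 2 ∷ (2 * l + 2) ∷ (l + 3) ∷ (replicate (l ∸ 1) 3 ++ replicate l 2 ++ replicate ((n ∸ 10 * l ∸ 4) / 2) 1)

partition≡witness : ∀ k r → partition (10 * suc k + 4 + r * 2) (suc k) ≡ blocks (witness k r)
partition≡witness k r = begin
  partition (10 * suc k + 4 + r * 2) (suc k)
    ≡⟨ cong₂ (λ a ones → a ∷ rest (replicate ones 1)) (largest-part (suc k) r) (ones-count (suc k) r) ⟩
  (2 * suc k + 2 + r) ∷ rest (replicate r 1)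
    ≡⟨ cong (λ ones → (2 * suc k + 2 + r) ∷ rest ones) (++-identityʳ (replicate r 1)) ⟨
  blocks (witness k r) ∎
  where
  open ≡-Reasoning
  rest : List ℕ → List ℕ
  rest ones = (2 * suc k + 2) ∷ (suc k + 3) ∷ (replicate k 3 ++ replicate (suc k) 2 ++ ones)

partition-eigenpartition : ∀ k r → let n = 10 * suc k + 4 + r * 2 in Eigenpartition n (suc k) (partition n (suc k))
partition-eigenpartition k r = subst (Eigenpartition (10 * suc k + 4 + r * 2) (suc k)) (sym (partition≡witness k r))
                                     (witness-isPartition k r , witness-eigenvalue k r)

lemma4 : (n l : ℕ) → 2 ∣ n → 14 ≤ n → 1 ≤ l → 10 * l + 4 ≤ n →
    (IsPartition n ((n ∸ 6 * l) / 2 ∷ (2 * l + 2) ∷ (l + 3) ∷ (replicate (l ∸ 1) 3 ++ replicate l 2 ++ replicate ((n ∸ 10 * l ∸ 4) / 2) 1))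
    × eigenvalueOf ((n ∸ 6 * l) / 2 ∷ (2 * l + 2) ∷ (l + 3) ∷ (replicate (l ∸ 1) 3 ++ replicate l 2 ++ replicate ((n ∸ 10 * l ∸ 4) / 2) 1)) ≡ + l)
    × IsEigenvalueT n (+ l)
-- 14 ≤ n is implied by 1 ≤ l and 10 * l + 4 ≤ n.
lemma4 n zero    _   _ () _
lemma4 n (suc k) 2∣n _ _  10l+4≤n = eigenpartition , partition n (suc k) , eigenpartition
  where
  2∣10l+4 : 2 ∣ 10 * suc k + 4
  2∣10l+4 = divides (5 * suc k + 2) (regroup k)
    where
    regroup : ∀ k → 10 * suc k + 4 ≡ (5 * suc k + 2) * 2
    regroup = solve-∀
  excess : Σ ℕ λ r → n ≡ 10 * suc k + 4 + r * 2
  excess = divisible-excess 2∣10l+4 2∣n 10l+4≤n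
  eigenpartition : Eigenpartition n (suc k) (partition n (suc k))
  eigenpartition = subst (λ m → Eigenpartition m (suc k) (partition m (suc k))) (sym (proj₂ excess))
                         (partition-eigenpartition k (proj₁ excess))
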